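{- Let $\mathcal{X}=\{x_1,\dots,x_N\}\subset\mathbb{R}^d$ be a finite dataset equipped with a metric $d$, and let $0\le k\le N-2$. Then $I_{k+1}\le I_k$, where $I_k$ denotes the number of clusters of the $k$-nearest-neighbor cluster set of $\mathcal{X}$ (defined in the context).
   Context: For $x\in\mathcal{X}$, order the points of $\mathcal{X}\setminus\{x\}$ by nondecreasing distance $d(x,\cdot)$ (ties broken by a fixed rule), and let $\mathcal{N}_k(x)$ be the set of the first $k$ points in this order (the $k$ nearest neighbors of $x$; $\mathcal{N}_0(x)=\emptyset$). The $k$-nearest-neighbor cluster set $\{\mathcal{C}_i^k\}_{i=1}^{I_k}$ is a partition of $\mathcal{X}$ into pairwise disjoint sets whose union is $\mathcal{X}$, such that each cluster contains the $k$ nearest neighbors of every one of its elements ($\mathcal{N}_k(x)\subseteq\mathcal{C}_i^k$ for all $x\in\mathcal{C}_i^k$), and $I_k$ is the maximum number of clusters among all partitions with this property. -}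

module Defs where

open import Level using (Level; _⊔_; 0ℓ)
open import Data.Nat using (ℕ; _∸_; _<_; _≤_)
open import Data.Fin using (Fin; toℕ)
import Data.Fin as F
open import Data.Product using (Σ; ∃; _×_)
open import Relation.Binary.Bundles using (TotalPreorder)
open import Relation.Binary.PropositionalEquality using (_≡_; _≢_)

-- Distances take values in a totally preordered set D (the reals with ≤
-- being the case of the paper).  Points of the dataset are indexed by Fin N.
module _ {c ℓ₁ ℓ₂ : Level} (D : TotalPreorder c ℓ₁ ℓ₂) where
  open TotalPreorder D renaming (Carrier to Dist)

  -- For every x, an enumeration of X \ {x} in nondecreasing order of
  -- d(x,·) (ties broken by a fixed rule, encoded by the choice of ord).
  record NeighbourOrder (N : ℕ) (d : Fin N → Fin N → Dist) : Set (c ⊔ ℓ₂) where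
    field
      ord          : Fin N → Fin (N ∸ 1) → Fin N
      ord-injective : ∀ x i j → ord x i ≡ ord x j → i ≡ j
      ord-avoids   : ∀ x i → ord x i ≢ x
      ord-covers   : ∀ x y → y ≢ x → ∃ λ i → ord x i ≡ y
      ord-monotone : ∀ x (i j : Fin (N ∸ 1)) → i F.≤ j → d x (ord x i) ≲ d x (ord x j)

  module _ {N : ℕ} {d : Fin N → Fin N → Dist} (O : NeighbourOrder N d) where
    open NeighbourOrder O

    _∈NN[_]_ : Fin N → ℕ → Fin N → Set
    y ∈NN[ k ] x = ∃ λ (i : Fin (N ∸ 1)) → (toℕ i < k) × (ord x i ≡ y)

    -- A partition of X into m nonempty pairwise disjoint clusters, given by
    -- a surjective cluster label c : X → Fin m, such that each cluster
    -- contains the k nearest neighbours of each of its elements.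
    IsKNNClusterSet : ℕ → (m : ℕ) → (Fin N → Fin m) → Set
    IsKNNClusterSet k m cl =
      (∀ (i : Fin m) → ∃ λ x → cl x ≡ i) ×
      (∀ x y → y ∈NN[ k ] x → cl y ≡ cl x)

    IsNumClusters : ℕ → ℕ → Set
    IsNumClusters k I =
      (Σ (Fin N → Fin I) λ cl → IsKNNClusterSet k I cl) ×
      (∀ m (cl : Fin N → Fin m) → IsKNNClusterSet k m cl → m ≤ I)

module Submission where

open import Defs
open import Level using (Level)
open import Data.Nat using (ℕ; _+_; _≤_)
open import Data.Nat.Properties using (<-≤-trans; m≤m+n)
open import Data.Fin using (Fin)
open import Data.Product using (_,_)
open import Relation.Binary.Bundles using (TotalPreorder)

module _ {c ℓ₁ ℓ₂ : Level} (D : TotalPreorder c ℓ₁ ℓ₂) {N : ℕ}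
         {d : Fin N → Fin N → TotalPreorder.Carrier D} (O : NeighbourOrder D N d) where

  ∈NN-mono : ∀ {k k′} → k ≤ k′ → ∀ {x y} → _∈NN[_]_ D O y k x → _∈NN[_]_ D O y k′ x
  ∈NN-mono k≤k′ (i , i<k , ord≡y) = i , <-≤-trans i<k k≤k′ , ord≡y

  IsKNNClusterSet-antimono : ∀ {k k′} → k ≤ k′ → ∀ {m} {cl : Fin N → Fin m} →
    IsKNNClusterSet D O k′ m cl → IsKNNClusterSet D O k m cl
  IsKNNClusterSet-antimono k≤k′ (surjective , closed) =
    surjective , λ x y y∈NN → closed x y (∈NN-mono k≤k′ y∈NN)

  IsNumClusters-antimono : ∀ {k k′} → k ≤ k′ → ∀ {I J} →
    IsNumClusters D O k I → IsNumClusters D O k′ J → J ≤ I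
  IsNumClusters-antimono k≤k′ (_ , maximal) ((cl , clusterSet) , _) =
    maximal _ cl (IsKNNClusterSet-antimono k≤k′ clusterSet)

corollary1 : {c ℓ₁ ℓ₂ : Level} (D : TotalPreorder c ℓ₁ ℓ₂) (N : ℕ)
    (d : Fin N → Fin N → TotalPreorder.Carrier D)
    (O : NeighbourOrder D N d) (k : ℕ) → k + 2 ≤ N →
    (I J : ℕ) → IsNumClusters D O k I → IsNumClusters D O (k + 1) J → J ≤ I
corollary1 D N d O k _ I J = IsNumClusters-antimono D O (m≤m+n k 1)
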